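{- Let $k$ be a positive integer and let $T$ be a standard $k$-tableau of weight $(1^m)$. For $1\le i\le m$ let $i^{\downarrow}$ denote the lowest cell of $T$ filled with $i$, and let $c_{(i)}$ denote the lowest addable cell of the shape $T_{\le i}$. Define $L(T)=[L_1,\dots,L_m]$ by $L_1=0$ and, for $2\le i\le m$, $$L_i=\begin{cases} L_{i-1}+1+\mathrm{diag}(i^{\downarrow},(i-1)^{\downarrow}) & \text{if } (i-1)^{\downarrow} \text{ is strictly below } i^{\downarrow},\\ L_{i-1}-\mathrm{diag}(i^{\downarrow},(i-1)^{\downarrow}) & \text{otherwise,}\end{cases}$$ and set $k\text{ -cocharge}(T)=\sum_{i=1}^m L_i$. Define $M(T)=[M_1,\dots,M_m]$ by $M_1=0$ and, for $2\le i\le m$, $M_i=M_{i-1}+1$ if $\mathrm{res}(i)>\mathrm{res}(i-1)$ in the low $T_{\le i}$-residue order, and $M_i=M_{i-1}$ otherwise. Then $$k\text{ -cocharge}(T)=\sum_{i=1}^m\left(M_i+\mathrm{diag}(i^{\downarrow},c_{(i)})\right).$$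
   Context: Partitions are drawn in French convention: the cell $(i,j)$ lies in the $i$-th row from the bottom and the $j$-th column from the left. The hook length $h_\lambda(c)$ of a cell $c=(i,j)$ of $\lambda$ is the number of cells of $\lambda$ to its right in row $i$, plus the number above it in column $j$, plus one. A $(k+1)$-core is a partition with no cell of hook length $k+1$. The ($(k+1)$-)residue of a cell $(i,j)$ (in $\lambda$ or not) is $(j-i) \bmod (k+1)$; the diagonal of a cell $(i,j)$ is the set of cells with the same value $j-i$, and its residue is $(j-i)\bmod (k+1)$. For two cells $c_1,c_2$, $\mathrm{diag}(c_1,c_2)$ is the number of diagonals of residue $r$ lying strictly between the diagonals of $c_1$ and $c_2$ (i.e. the number of integers $d$ strictly between the values $j-i$ of $c_1$ and $c_2$ with $d\equiv r \bmod (k+1)$), where $r$ is the residue of the lower of the two cells. A $k$-tableau of shape $\lambda$ (a $(k+1)$-core with $m$ cells of hook length $\le k$) and weight $\alpha=(\alpha_1,\dots,\alpha_r)$ (a composition of $m$ with all parts $\le k$) is a filling of the cells of $\lambda$ with $1,\dots,r$ such that for each $i$ the cells filled with letters $\le i$ form a $(k+1)$-core $\lambda^{(i)}$, $\lambda^{(i)}/\lambda^{(i-1)}$ is a horizontal strip, and the cells filled with $i$ carry exactly $\alpha_i$ distinct residues. It is standard if the weight is $(1^m)$; then all cells containing $i$ have the same residue, denoted $\mathrm{res}(i)$. For a standard $k$-tableau $T$, $T_{\le i}$ is the set of cells filled with letters $j\le i$ (a $(k+1)$-core shape). An addable cell of a partition shape $\mu$ is a cell not in $\mu$ whose addition gives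 a partition; the lowest addable cell is the one in the lowest row. The low $T$-residue order on $\{0,1,\dots,k\}$ is $x>x+1>\cdots>k>0>1>\cdots>x-1$, where $x$ is the residue of the lowest addable cell of the shape of $T$; the low $T_{\le i}$-residue order is the same with $T_{\le i}$ in place of $T$. -}

module Defs where

open import Data.Nat as ℕ using (ℕ; zero; suc; _+_; _∸_; _%_; _<_; _≤_; _<ᵇ_; _≡ᵇ_)
open import Data.Integer as ℤ using (ℤ; +_; ∣_∣) renaming (_+_ to _+ℤ_; _-_ to _-ℤ_; _⊓_ to _⊓ℤ_)
open import Data.Integer.DivMod using (_%ℕ_)
open import Data.List using (List; []; _∷_; length)
open import Data.Bool using (Bool; true; false; if_then_else_; _∧_; _∨_)
open import Data.Product using (_×_; _,_; proj₁; proj₂; ∃-syntax)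
open import Data.Sum using (_⊎_)
open import Relation.Nullary using (¬_)
open import Relation.Binary.PropositionalEquality using (_≡_; _≢_)

-- A partition is a list of row lengths, listed from the BOTTOM row up
-- (French convention).  Rows and columns are indexed from 0 here (the
-- paper indexes from 1; contents j - i, residues and diagonals are
-- unchanged by this simultaneous shift).  A cell is (row , column).

Partition : Set
Partition = List ℕ

Cell : Set
Cell = ℕ × ℕ

row : Partition → ℕ → ℕ
row []       _       = 0
row (x ∷ _)  zero    = x
row (_ ∷ xs) (suc r) = row xs r

IsPartition : Partition → Set
IsPartition μ = (∀ r → r < length μ → 0 < row μ r)
              × (∀ r → row μ (suc r) ≤ row μ r)

_∈P_ : Cell → Partition → Set
(r , c) ∈P μ = c < row μ r

count : ℕ → (ℕ → Bool) → ℕ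
count zero    p = 0
count (suc n) p = count n p + (if p n then 1 else 0)

sumBelow : ℕ → (ℕ → ℕ) → ℕ
sumBelow zero    f = 0
sumBelow (suc n) f = sumBelow n f + f n

sum1to : ℕ → (ℕ → ℕ) → ℕ
sum1to zero    f = 0
sum1to (suc n) f = sum1to n f + f (suc n)

sum1toℤ : ℕ → (ℕ → ℤ) → ℤ
sum1toℤ zero    f = + 0
sum1toℤ (suc n) f = sum1toℤ n f +ℤ f (suc n)

-- the least i < n with p i, or n if there is none
findFirst : ℕ → (ℕ → Bool) → ℕ
findFirst zero    p = zero
findFirst (suc n) p = if p 0 then 0 else suc (findFirst n (λ i → p (suc i)))

arm : Partition → Cell → ℕ
arm μ (r , c) = row μ r ∸ suc c

leg : Partition → Cell → ℕ
leg μ (r , c) = count (length μ) (λ r′ → (r <ᵇ r′) ∧ (c <ᵇ row μ r′))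

hook : Partition → Cell → ℕ
hook μ x = arm μ x + leg μ x + 1

IsCore : ℕ → Partition → Set
IsCore k μ = ∀ (x : Cell) → x ∈P μ → hook μ x ≢ suc k

kSize : ℕ → Partition → ℕ
kSize k μ = sumBelow (length μ) (λ r →
              count (row μ r) (λ c → hook μ (r , c) <ᵇ suc k))

content : Cell → ℤ
content (r , c) = + c -ℤ + r

residue : ℕ → Cell → ℕ
residue k x = content x %ℕ suc k

-- diag(c₁,c₂): number of integers d strictly between content c₁ and
-- content c₂ with d ≡ ρ mod (k+1), ρ the residue of the lower of the two
-- cells (the one in the lower row; if both lie in the same row we take c₁).
diag : ℕ → Cell → Cell → ℕ
diag k c₁ c₂ =
  let lower = if proj₁ c₂ <ᵇ proj₁ c₁ then c₂ else c₁
      ρ     = residue k lower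
      lo    = content c₁ ⊓ℤ content c₂
      gap   = ∣ content c₁ -ℤ content c₂ ∣
  in count gap (λ t → (0 <ᵇ t) ∧ ((lo +ℤ + t) %ℕ suc k ≡ᵇ ρ))

IsAddable : Partition → Cell → Set
IsAddable μ (r , c) = (c ≡ row μ r) × ((r ≡ 0) ⊎ (c < row μ (r ∸ 1)))

addableRow? : Partition → ℕ → Bool
addableRow? μ r = (r ≡ᵇ 0) ∨ (row μ r <ᵇ row μ (r ∸ 1))

-- the lowest addable cell of μ (addable cells lie in rows 0 … length μ)
lowestAddable : Partition → Cell
lowestAddable μ =
  let r = findFirst (suc (length μ)) (addableRow? μ) in (r , row μ r)

-- standard k-tableaux of weight (1^m), as a chain of shapes
-- ∅ = λ⁽⁰⁾ ⊆ λ⁽¹⁾ ⊆ … ⊆ λ⁽ᵐ⁾ ; the cells filled with i are λ⁽ⁱ⁾ / λ⁽ⁱ⁻¹⁾,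
-- so  sh i  is the shape of T_{≤ i}.

record StdKTableau (k m : ℕ) : Set where
  field
    sh       : ℕ → Partition
    sh-zero  : sh 0 ≡ []
    sh-part  : ∀ i → i ≤ m → IsPartition (sh i)
    sh-core  : ∀ i → i ≤ m → IsCore k (sh i)
    sh-incl  : ∀ i → suc i ≤ m → ∀ r → row (sh i) r ≤ row (sh (suc i)) r
    -- λ⁽ⁱ⁺¹⁾ / λ⁽ⁱ⁾ is a horizontal strip
    sh-horiz : ∀ i → suc i ≤ m → ∀ r → row (sh (suc i)) (suc r) ≤ row (sh i) r
    sh-res   : ∀ i → suc i ≤ m →
               ∃[ ρ ] (∃[ x ] (x ∈P sh (suc i) × ¬ (x ∈P sh i)))
                    × (∀ x → x ∈P sh (suc i) → ¬ (x ∈P sh i) → residue k x ≡ ρ)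
    -- the weight (1^m) is a composition of m = number of cells of
    -- hook length ≤ k of the shape
    sh-size  : kSize k (sh m) ≡ m

module _ (k : ℕ) (sh : ℕ → Partition) where

  -- i↓ : the lowest cell filled with i (i ≥ 1); it is the leftmost new
  -- cell in the lowest row where λ⁽ⁱ⁾ exceeds λ⁽ⁱ⁻¹⁾ (for a standard
  -- k-tableau there is exactly one new cell in that row)
  lowCell : ℕ → Cell
  lowCell i =
    let r = findFirst (length (sh i)) (λ r → row (sh (i ∸ 1)) r <ᵇ row (sh i) r)
    in (r , row (sh (i ∸ 1)) r)

  res : ℕ → ℕ
  res i = residue k (lowCell i)

  lowAdd : ℕ → Cell
  lowAdd i = lowestAddable (sh i)

  -- position of a in the low order x > x+1 > … > k > 0 > … > x-1
  -- (position 0 is the largest element)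
  lowRank : ℕ → ℕ → ℕ
  lowRank x a = (a + (suc k ∸ x)) % suc k

  lowGreater : ℕ → ℕ → ℕ → Bool
  lowGreater i a b = lowRank (residue k (lowAdd i)) a <ᵇ lowRank (residue k (lowAdd i)) b

  Lw : ℕ → ℤ
  Lw zero          = + 0
  Lw (suc zero)    = + 0
  Lw (suc (suc i)) =
    let a = lowCell (suc (suc i))
        b = lowCell (suc i)
    in if proj₁ b <ᵇ proj₁ a
       then Lw (suc i) +ℤ + 1 +ℤ + diag k a b
       else Lw (suc i) -ℤ + diag k a b

  Mw : ℕ → ℕ
  Mw zero          = 0
  Mw (suc zero)    = 0
  Mw (suc (suc i)) =
    if lowGreater (suc (suc i)) (res (suc (suc i))) (res (suc i))
    then suc (Mw (suc i)) else Mw (suc i)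

  kCocharge : ℕ → ℤ
  kCocharge m = sum1toℤ m Lw

-- By induction on i, L_i = M_i + diag(i↓, c_(i)).  For the step from the letter j to j+1,
-- measure every cell (r, c) by its offset P = W + r − c, where W is the bottom row of
-- T_{≤ j+1}; its content is then W − P.  In these terms diag between two cells is
-- ⌊(|P − P′| − 1)/(k+1)⌋, c_(j+1) has offset 0, and the rank of a residue in the low
-- T_{≤ j+1}-order is −P mod k+1.  The recursion for L thus becomes an identity between
-- floor quotients whose correction term is a carry, and that carry is exactly the
-- comparison defining M.  When (j+1)↓ is weakly below j↓ the identity also needs the two
-- offsets to be incongruent mod k+1.  This is where the core property enters: on the
-- abacus of T_{≤ j} the first offset is a bead and the second a gap, while in a
-- (k+1)-core a bead at s forces a bead at s + k + 1, since otherwise the first row whose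
-- bead passes s + k + 1 contains a cell of hook length k + 1.
module Submission where

open import Defs
open import Data.Bool using (Bool; true; false; if_then_else_; _∧_; T)
open import Data.Bool.Properties using (∧-identityʳ; ∧-zeroʳ)
open import Data.Empty using (⊥-elim)
open import Data.Integer as ℤ using (+_; -[1+_]; _%ℕ_; _/ℕ_; ∣_∣; _⊖_)
  renaming (_+_ to _+ℤ_; _*_ to _*ℤ_; _-_ to _-ℤ_; -_ to -ℤ_; _⊓_ to _⊓ℤ_)
import Data.Integer.DivMod as ℤ
import Data.Integer.Properties as ℤ
import Data.Integer.Tactic.RingSolver as ℤ-Solver
open import Data.List using (_∷_; length)
open import Data.Nat using (ℕ; zero; suc; pred; _+_; _*_; _∸_; _%_; _/_; _<_; _≤_; _<ᵇ_; _≡ᵇ_;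
  z≤n; s≤s; z<s; NonZero; >-nonZero⁻¹; ∣_-_∣; _≤′_; ≤′-refl; ≤′-step)
open import Data.Nat.DivMod
open import Data.Nat.Divisibility using (n∣m*n)
open import Data.Nat.Properties
open import Data.Nat.Tactic.RingSolver using (solve-∀)
open import Data.Product using (_×_; _,_; proj₁; proj₂; ∃-syntax)
open import Data.Sum using (_⊎_; inj₁; inj₂)
open import Relation.Binary using (tri<; tri≈; tri>)
open import Relation.Binary.PropositionalEquality
  using (_≡_; _≢_; refl; sym; trans; cong; cong₂; subst; module ≡-Reasoning)
open import Relation.Nullary using (¬_; yes; no; contradiction)

[_] : Bool → ℕ
[ b ] = if b then 1 else 0

if-then-suc : ∀ b n → (if b then suc n else n) ≡ [ b ] + n
if-then-suc true  n = refl
if-then-suc false n = refl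

T-injective : ∀ {a b} → (T a → T b) → (T b → T a) → a ≡ b
T-injective {false} {false} _   _   = refl
T-injective {false} {true}  _   b⇒a = ⊥-elim (b⇒a _)
T-injective {true}  {false} a⇒b _   = ⊥-elim (a⇒b _)
T-injective {true}  {true}  _   _   = refl

<ᵇ-true : ∀ {m n} → m < n → (m <ᵇ n) ≡ true
<ᵇ-true m<n = T-injective (λ _ → _) (λ _ → <⇒<ᵇ m<n)

<ᵇ-false : ∀ {m n} → ¬ m < n → (m <ᵇ n) ≡ false
<ᵇ-false {m} {n} m≮n = T-injective (λ m<ᵇn → m≮n (<ᵇ⇒< m n m<ᵇn)) (λ ())

<ᵇ-exclusive : ∀ {x y} → x ≢ y → [ x <ᵇ y ] + [ y <ᵇ x ] ≡ 1
<ᵇ-exclusive {x} {y} x≢y with <-cmp x y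
... | tri< x<y _ y≮x = cong₂ (λ p q → [ p ] + [ q ]) (<ᵇ-true x<y) (<ᵇ-false y≮x)
... | tri≈ _ x≡y _   = contradiction x≡y x≢y
... | tri> x≮y _ y<x = cong₂ (λ p q → [ p ] + [ q ]) (<ᵇ-false x≮y) (<ᵇ-true y<x)

∸-<ᵇ-flip : ∀ {k x y} → x ≤ k → (k ∸ x <ᵇ k ∸ y) ≡ (y <ᵇ x)
∸-<ᵇ-flip {k} {x} {y} x≤k = T-injective
  (λ lt → <⇒<ᵇ (≰⇒> {x} {y} (λ x≤y → <⇒≱ (<ᵇ⇒< (k ∸ x) (k ∸ y) lt) (∸-monoʳ-≤ k x≤y))))
  (λ lt → <⇒<ᵇ (∸-monoʳ-< {k} {x} {y} (<ᵇ⇒< y x lt) x≤k))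

≡ᵇ-cong : ∀ {x y x′ y′} → (x ≡ y → x′ ≡ y′) → (x′ ≡ y′ → x ≡ y) → (x ≡ᵇ y) ≡ (x′ ≡ᵇ y′)
≡ᵇ-cong {x} {y} {x′} {y′} to from =
  T-injective (λ t → ≡⇒≡ᵇ x′ y′ (to (≡ᵇ⇒≡ x y t))) (λ t → ≡⇒≡ᵇ x y (from (≡ᵇ⇒≡ x′ y′ t)))

count-cong : ∀ N {p q : ℕ → Bool} → (∀ {t} → t < N → p t ≡ q t) → count N p ≡ count N q
count-cong zero    p≡q = refl
count-cong (suc N) p≡q = cong₂ _+_ (count-cong N (λ t<N → p≡q (m<n⇒m<1+n t<N))) (cong [_] (p≡q ≤-refl))

count-suc : ∀ N (p : ℕ → Bool) → count (suc N) p ≡ [ p 0 ] + count N (λ t → p (suc t))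
count-suc zero    p = sym (+-identityʳ [ p 0 ])
count-suc (suc N) p = trans (cong (_+ [ p (suc N) ]) (count-suc N p)) (+-assoc [ p 0 ] _ _)

count-reverse : ∀ N (p : ℕ → Bool) → count N p ≡ count N (λ t → p (N ∸ suc t))
count-reverse zero    p = refl
count-reverse (suc N) p = begin
    count N p + [ p N ]                       ≡⟨ cong (_+ [ p N ]) (count-reverse N p) ⟩
    count N (λ t → p (N ∸ suc t)) + [ p N ]   ≡⟨ +-comm _ [ p N ] ⟩
    [ p N ] + count N (λ t → p (N ∸ suc t))   ≡⟨ count-suc N (λ t → p (N ∸ t)) ⟨
    count (suc N) (λ t → p (N ∸ t))           ∎
  where open ≡-Reasoning

count-reverse-open : ∀ g (p : ℕ → Bool) →
                     count g (λ t → (0 <ᵇ t) ∧ p t) ≡ count g (λ t → (0 <ᵇ t) ∧ p (g ∸ t))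
count-reverse-open zero    p = refl
count-reverse-open (suc g) p = begin
    count (suc g) (λ t → (0 <ᵇ t) ∧ p t)             ≡⟨ count-suc g (λ t → (0 <ᵇ t) ∧ p t) ⟩
    count g (λ t → p (suc t))                        ≡⟨ count-reverse g (λ t → p (suc t)) ⟩
    count g (λ t → p (suc (g ∸ suc t)))              ≡⟨ count-cong g (λ t<g → cong p (sym (+-∸-assoc 1 t<g))) ⟩
    count g (λ t → p (g ∸ t))                        ≡⟨ count-suc g (λ t → (0 <ᵇ t) ∧ p (suc g ∸ t)) ⟨
    count (suc g) (λ t → (0 <ᵇ t) ∧ p (suc g ∸ t))   ∎
  where open ≡-Reasoning

count-prefix : ∀ {q N} (p : ℕ → Bool) → q ≤ N → (∀ {t} → q ≤ t → t < N → p t ≡ false) →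
               count N p ≡ count q p
count-prefix {q} p q≤N = go (≤⇒≤′ q≤N)
  where
    go : ∀ {N} → q ≤′ N → (∀ {t} → q ≤ t → t < N → p t ≡ false) → count N p ≡ count q p
    go ≤′-refl          _      = refl
    go (≤′-step q≤′N) p-false = trans
      (cong₂ _+_ (go q≤′N (λ q≤t t<N → p-false q≤t (m<n⇒m<1+n t<N))) (cong [_] (p-false (≤′⇒≤ q≤′N) ≤-refl)))
      (+-identityʳ (count q p))

count-above : ∀ r q → count q (r <ᵇ_) ≡ q ∸ suc r
count-above r zero = refl
count-above r (suc q) with r <? q
... | yes r<q = begin
    count q (r <ᵇ_) + [ r <ᵇ q ]   ≡⟨ cong₂ _+_ (count-above r q) (cong [_] (<ᵇ-true r<q)) ⟩
    q ∸ suc r + 1                  ≡⟨ +-comm (q ∸ suc r) 1 ⟩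
    suc (q ∸ suc r)                ≡⟨ +-∸-assoc 1 r<q ⟨
    suc q ∸ suc r                  ∎
  where open ≡-Reasoning
... | no r≮q = begin
    count q (r <ᵇ_) + [ r <ᵇ q ]   ≡⟨ cong₂ _+_ (count-above r q) (cong [_] (<ᵇ-false r≮q)) ⟩
    q ∸ suc r + 0                  ≡⟨ +-identityʳ (q ∸ suc r) ⟩
    q ∸ suc r                      ≡⟨ m≤n⇒m∸n≡0 (m≤n⇒m≤1+n (≮⇒≥ r≮q)) ⟩
    0                              ≡⟨ m≤n⇒m∸n≡0 (≮⇒≥ r≮q) ⟨
    q ∸ r                          ∎
  where open ≡-Reasoning

findFirst-spec : ∀ N (p : ℕ → Bool) {j} → j < N → T (p j) →
                 T (p (findFirst N p)) × (∀ {i} → i < findFirst N p → ¬ T (p i))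
findFirst-spec (suc N) p {j} j<N pj with p 0 in p0
... | true  = subst T (sym p0) _ , λ ()
findFirst-spec (suc N) p {zero}  j<N       pj | false = ⊥-elim (subst T p0 pj)
findFirst-spec (suc N) p {suc j} (s≤s j<N) pj | false with findFirst-spec N (λ i → p (suc i)) j<N pj
... | found , before = found , λ { {zero} _ → subst T p0 ; {suc i} (s≤s i<) → before i< }

-- Division with remainder

<⇒+-suc-∸ : ∀ {x y} → x < y → x + suc (y ∸ suc x) ≡ y
<⇒+-suc-∸ {x} {y} x<y = trans (+-suc x (y ∸ suc x)) (m+[n∸m]≡n x<y)

private
  digit-sum : ∀ a b p q n → (a + p * n) + suc (b + q * n) ≡ (a + suc b) + (p + q) * n
  digit-sum = solve-∀

  shift-multiple : ∀ n s q → (n + s) + q * n ≡ s + suc q * n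
  shift-multiple = solve-∀

module _ (n : ℕ) .{{_ : NonZero n}} where

  0%n≡0 : 0 % n ≡ 0
  0%n≡0 = m<n⇒m%n≡m (>-nonZero⁻¹ n)

  %-absorbˡ : ∀ a b → (a % n + b) % n ≡ (a + b) % n
  %-absorbˡ a b = begin
    (a % n + b) % n           ≡⟨ %-distribˡ-+ (a % n) b n ⟩
    (a % n % n + b % n) % n   ≡⟨ cong (λ v → (v + b % n) % n) (m%n%n≡m%n a n) ⟩
    (a % n + b % n) % n       ≡⟨ %-distribˡ-+ a b n ⟨
    (a + b) % n               ∎
    where open ≡-Reasoning

  %-absorbʳ : ∀ a b → (a + b % n) % n ≡ (a + b) % n
  %-absorbʳ a b = trans (cong (_% n) (+-comm a (b % n))) (trans (%-absorbˡ b a) (cong (_% n) (+-comm b a)))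

  %-/-unique : ∀ {m r} q → r < n → m ≡ r + q * n → m % n ≡ r × m / n ≡ q
  %-/-unique {r = r} q r<n refl =
    trans ([m+kn]%n≡m%n r q n) (m<n⇒m%n≡m r<n) ,
    trans (+-distrib-/-∣ʳ r (n∣m*n q)) (cong₂ _+_ (m<n⇒m/n≡0 r<n) (m*n/n≡m q n))

  private
    +-suc-by-digits : ∀ x y → x + suc y ≡ (x % n + suc (y % n)) + (x / n + y / n) * n
    +-suc-by-digits x y = begin
      x + suc y                                       ≡⟨ cong₂ (λ a b → a + suc b) (m≡m%n+[m/n]*n x n) (m≡m%n+[m/n]*n y n) ⟩
      (x % n + x / n * n) + suc (y % n + y / n * n)   ≡⟨ digit-sum (x % n) (y % n) (x / n) (y / n) n ⟩
      (x % n + suc (y % n)) + (x / n + y / n) * n     ∎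
      where open ≡-Reasoning

  -- Adding suc y to x carries past a multiple of n exactly when the remainder does not increase.
  /-+-suc : ∀ x y → (x + suc y) / n + [ x % n <ᵇ (x + suc y) % n ] ≡ suc (x / n + y / n)
  /-+-suc x y with x % n + suc (y % n) <? n
  ... | yes no-carry = begin
      (x + suc y) / n + [ X <ᵇ (x + suc y) % n ]   ≡⟨ cong₂ (λ q r → q + [ X <ᵇ r ]) quot rem ⟩
      Q + [ X <ᵇ X + suc (y % n) ]                 ≡⟨ cong (λ b → Q + [ b ]) (<ᵇ-true (m<m+n X z<s)) ⟩
      Q + 1                                        ≡⟨ +-comm Q 1 ⟩
      suc Q                                        ∎
    where
      open ≡-Reasoning
      X = x % n
      Q = x / n + y / n
      rem = proj₁ (%-/-unique Q no-carry (+-suc-by-digits x y))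
      quot = proj₂ (%-/-unique Q no-carry (+-suc-by-digits x y))
  ... | no carry = begin
      (x + suc y) / n + [ X <ᵇ (x + suc y) % n ]   ≡⟨ cong₂ (λ q r → q + [ X <ᵇ r ]) quot rem ⟩
      suc Q + [ X <ᵇ s ]                           ≡⟨ cong (λ b → suc Q + [ b ]) (<ᵇ-false (≤⇒≯ s≤X)) ⟩
      suc Q + 0                                    ≡⟨ +-identityʳ (suc Q) ⟩
      suc Q                                        ∎
    where
      open ≡-Reasoning
      X = x % n
      Q = x / n + y / n
      s = X + suc (y % n) ∸ n
      overflow : n + s ≡ X + suc (y % n)
      overflow = m+[n∸m]≡n (≮⇒≥ carry)
      s<n : s < n
      s<n = +-cancelˡ-< n s n (subst (_< n + n) (sym overflow) (+-mono-<-≤ (m%n<n x n) (m%n<n y n)))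
      s≤X : s ≤ X
      s≤X = +-cancelʳ-≤ n s X (subst (_≤ X + n) (trans (sym overflow) (+-comm n s)) (+-monoʳ-≤ X (m%n<n y n)))
      wrapped : x + suc y ≡ s + suc Q * n
      wrapped = trans (+-suc-by-digits x y) (trans (cong (_+ Q * n) (sym overflow)) (shift-multiple n s Q))
      rem = proj₁ (%-/-unique (suc Q) s<n wrapped)
      quot = proj₂ (%-/-unique (suc Q) s<n wrapped)

  suc-/ : ∀ x → suc x / n ≡ x / n + [ suc x % n ≡ᵇ 0 ]
  suc-/ x with suc (x % n) <? n
  ... | yes below = begin
      suc x / n                  ≡⟨ proj₂ (%-/-unique Q below succ) ⟩
      Q                          ≡⟨ +-identityʳ Q ⟨
      Q + [ suc (x % n) ≡ᵇ 0 ]   ≡⟨ cong (λ r → Q + [ r ≡ᵇ 0 ]) (proj₁ (%-/-unique Q below succ)) ⟨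
      Q + [ suc x % n ≡ᵇ 0 ]     ∎
    where
      open ≡-Reasoning
      Q = x / n
      succ : suc x ≡ suc (x % n) + Q * n
      succ = cong suc (m≡m%n+[m/n]*n x n)
  ... | no full = begin
      suc x / n                  ≡⟨ proj₂ (%-/-unique (suc Q) (>-nonZero⁻¹ n) wrap) ⟩
      suc Q                      ≡⟨ +-comm 1 Q ⟩
      Q + 1                      ≡⟨ cong (λ r → Q + [ r ≡ᵇ 0 ]) (proj₁ (%-/-unique (suc Q) (>-nonZero⁻¹ n) wrap)) ⟨
      Q + [ suc x % n ≡ᵇ 0 ]     ∎
    where
      open ≡-Reasoning
      Q = x / n
      wrap : suc x ≡ 0 + suc Q * n
      wrap = trans (cong suc (m≡m%n+[m/n]*n x n)) (cong (_+ Q * n) (≤-antisym (m%n<n x n) (≮⇒≥ full)))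

  multiples-below : ∀ g → count g (λ t → (0 <ᵇ t) ∧ (t % n ≡ᵇ 0)) ≡ pred g / n
  multiples-below zero          = sym (0/n≡0 n)
  multiples-below (suc zero)    = sym (0/n≡0 n)
  multiples-below (suc (suc g)) =
    trans (cong (_+ [ suc g % n ≡ᵇ 0 ]) (multiples-below (suc g))) (sym (suc-/ g))

private
  cancel-multiple : ∀ a d n → (a +ℤ d *ℤ n) +ℤ (-ℤ d) *ℤ n ≡ a
  cancel-multiple = ℤ-Solver.solve-∀

  change-quotient : ∀ a b z q n → a +ℤ q *ℤ n ≡ b +ℤ z *ℤ n → a ≡ b +ℤ (z -ℤ q) *ℤ n
  change-quotient a b z q n eq = begin
      a                         ≡⟨ drop-multiple a q n ⟨
      (a +ℤ q *ℤ n) -ℤ q *ℤ n   ≡⟨ cong (_-ℤ q *ℤ n) eq ⟩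
      (b +ℤ z *ℤ n) -ℤ q *ℤ n   ≡⟨ merge-multiples b z q n ⟩
      b +ℤ (z -ℤ q) *ℤ n        ∎
    where
      open ≡-Reasoning
      drop-multiple : ∀ a q n → (a +ℤ q *ℤ n) -ℤ q *ℤ n ≡ a
      drop-multiple = ℤ-Solver.solve-∀
      merge-multiples : ∀ b z q n → (b +ℤ z *ℤ n) -ℤ q *ℤ n ≡ b +ℤ (z -ℤ q) *ℤ n
      merge-multiples = ℤ-Solver.solve-∀

module _ (n : ℕ) .{{_ : NonZero n}} where

  +r≡+r′+d*n⇒r≡r′ : ∀ {r r′} d → r < n → r′ < n → + r ≡ + r′ +ℤ d *ℤ + n → r ≡ r′
  +r≡+r′+d*n⇒r≡r′ {r} {r′} (+ zero) _ _ eq =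
    ℤ.+-injective (trans eq (trans (cong ((+ r′) +ℤ_) (ℤ.*-zeroˡ (+ n))) (ℤ.+-identityʳ (+ r′))))
  +r≡+r′+d*n⇒r≡r′ {r} {r′} (+ suc e) r<n _ eq = contradiction r<n (≤⇒≯ n≤r)
    where
      r≡ : r ≡ r′ + suc e * n
      r≡ = ℤ.+-injective (trans eq (trans (cong ((+ r′) +ℤ_) (sym (ℤ.pos-* (suc e) n))) (sym (ℤ.pos-+ r′ (suc e * n)))))
      n≤r : n ≤ r
      n≤r = subst (n ≤_) (sym r≡) (≤-trans (m≤m+n n (e * n)) (m≤n+m (suc e * n) r′))
  +r≡+r′+d*n⇒r≡r′ {r} {r′} -[1+ e ] r<n r′<n eq = sym (+r≡+r′+d*n⇒r≡r′ (+ suc e) r′<n r<n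
    (sym (trans (cong (_+ℤ + suc e *ℤ + n) eq) (cancel-multiple (+ r′) -[1+ e ] (+ n)))))

  %ℕ-unique : ∀ {i r} z → r < n → i ≡ + r +ℤ z *ℤ + n → i %ℕ n ≡ r
  %ℕ-unique {i} {r} z r<n eq = +r≡+r′+d*n⇒r≡r′ (z -ℤ i /ℕ n) (ℤ.n%ℕd<d i n) r<n
    (change-quotient (+ (i %ℕ n)) (+ r) z (i /ℕ n) (+ n) (trans (sym (ℤ.a≡a%ℕn+[a/ℕn]*n i n)) eq))

  %ℕ-distrib-+ : ∀ i j → (i +ℤ j) %ℕ n ≡ (i %ℕ n + j %ℕ n) % n
  %ℕ-distrib-+ i j = %ℕ-unique (+ (S / n) +ℤ (i /ℕ n +ℤ j /ℕ n)) (m%n<n S n) (begin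
      i +ℤ j
        ≡⟨ cong₂ _+ℤ_ (ℤ.a≡a%ℕn+[a/ℕn]*n i n) (ℤ.a≡a%ℕn+[a/ℕn]*n j n) ⟩
      (+ (i %ℕ n) +ℤ i /ℕ n *ℤ + n) +ℤ (+ (j %ℕ n) +ℤ j /ℕ n *ℤ + n)
        ≡⟨ collect (+ (i %ℕ n)) (+ (j %ℕ n)) (i /ℕ n) (j /ℕ n) (+ n) ⟩
      + S +ℤ (i /ℕ n +ℤ j /ℕ n) *ℤ + n
        ≡⟨ cong (_+ℤ (i /ℕ n +ℤ j /ℕ n) *ℤ + n) S≡ ⟩
      (+ (S % n) +ℤ + (S / n) *ℤ + n) +ℤ (i /ℕ n +ℤ j /ℕ n) *ℤ + n
        ≡⟨ reassociate (+ (S % n)) (+ (S / n)) (i /ℕ n +ℤ j /ℕ n) (+ n) ⟩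
      + (S % n) +ℤ (+ (S / n) +ℤ (i /ℕ n +ℤ j /ℕ n)) *ℤ + n ∎)
    where
      open ≡-Reasoning
      S = i %ℕ n + j %ℕ n
      S≡ : + S ≡ + (S % n) +ℤ + (S / n) *ℤ + n
      S≡ = trans (cong +_ (m≡m%n+[m/n]*n S n))
                 (trans (ℤ.pos-+ (S % n) (S / n * n)) (cong (+ (S % n) +ℤ_) (ℤ.pos-* (S / n) n)))
      collect : ∀ a b p q n → (a +ℤ p *ℤ n) +ℤ (b +ℤ q *ℤ n) ≡ (a +ℤ b) +ℤ (p +ℤ q) *ℤ n
      collect = ℤ-Solver.solve-∀
      reassociate : ∀ a p q n → (a +ℤ p *ℤ n) +ℤ q *ℤ n ≡ a +ℤ (p +ℤ q) *ℤ n
      reassociate = ℤ-Solver.solve-∀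

  %ℕ-+-cancelˡ : ∀ i t u → (i +ℤ + t) %ℕ n ≡ (i +ℤ + u) %ℕ n → t % n ≡ u % n
  %ℕ-+-cancelˡ i t u eq = begin
      t % n                                  ≡⟨ unshift t ⟩
      ((-ℤ i) %ℕ n + (i +ℤ + t) %ℕ n) % n    ≡⟨ cong (λ r → ((-ℤ i) %ℕ n + r) % n) eq ⟩
      ((-ℤ i) %ℕ n + (i +ℤ + u) %ℕ n) % n    ≡⟨ unshift u ⟨
      u % n                                  ∎
    where
      open ≡-Reasoning
      neg-shift : ∀ i a → -ℤ i +ℤ (i +ℤ a) ≡ a
      neg-shift = ℤ-Solver.solve-∀
      unshift : ∀ t → t % n ≡ ((-ℤ i) %ℕ n + (i +ℤ + t) %ℕ n) % n
      unshift t = trans (cong (_%ℕ n) (sym (neg-shift i (+ t)))) (%ℕ-distrib-+ (-ℤ i) (i +ℤ + t))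

  %ℕ-+-≡ᵇ : ∀ i t u → ((i +ℤ + t) %ℕ n ≡ᵇ (i +ℤ + u) %ℕ n) ≡ (t % n ≡ᵇ u % n)
  %ℕ-+-≡ᵇ i t u = ≡ᵇ-cong (%ℕ-+-cancelˡ i t u) (λ eq →
    trans (%ℕ-distrib-+ i (+ t)) (trans (cong (λ r → (i %ℕ n + r) % n) eq) (sym (%ℕ-distrib-+ i (+ u)))))

  +-%-cancelˡ-< : ∀ a {x y} → x < n → y < n → (a + x) % n ≡ (a + y) % n → x ≡ y
  +-%-cancelˡ-< a {x} {y} x<n y<n eq =
    trans (sym (m<n⇒m%n≡m x<n)) (trans (%ℕ-+-cancelˡ (+ a) x y eq) (m<n⇒m%n≡m y<n))

  private
    carry-regroup : ∀ M p q → M + p + 1 + q ≡ M + suc (p + q)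
    carry-regroup = solve-∀
    move-indicator : ∀ M q g → M + (q + g) ≡ g + M + q
    move-indicator = solve-∀
    move-indicator′ : ∀ M g p q → M + (g + p + q) ≡ g + M + p + q
    move-indicator′ = solve-∀
    swap-indicator : ∀ g p q → suc (p + q) + g ≡ g + p + q + 1
    swap-indicator = solve-∀

  /-carry-< : ∀ M {a b} → b < a → M + b / n + 1 + pred ∣ a - b ∣ / n ≡ [ b % n <ᵇ a % n ] + M + a / n
  /-carry-< M {a} {b} b<a with m≤n⇒∃[o]m+o≡n b<a
  ... | y , refl = subst (λ a → M + b / n + 1 + pred ∣ a - b ∣ / n ≡ [ b % n <ᵇ a % n ] + M + a / n)
                         (+-suc b y) (begin
      M + b / n + 1 + pred ∣ b + suc y - b ∣ / n
        ≡⟨ cong (λ g → M + b / n + 1 + pred g / n) (trans (∣-∣-comm (b + suc y) b) (∣m-m+n∣≡n b (suc y))) ⟩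
      M + b / n + 1 + y / n
        ≡⟨ carry-regroup M (b / n) (y / n) ⟩
      M + suc (b / n + y / n)
        ≡⟨ cong (λ v → M + v) (/-+-suc n b y) ⟨
      M + ((b + suc y) / n + [ b % n <ᵇ (b + suc y) % n ])
        ≡⟨ move-indicator M ((b + suc y) / n) [ b % n <ᵇ (b + suc y) % n ] ⟩
      [ b % n <ᵇ (b + suc y) % n ] + M + (b + suc y) / n ∎)
    where open ≡-Reasoning

  /-carry-> : ∀ M {a b} → a < b → (b ∸ a) % n ≢ 0 →
              M + b / n ≡ [ b % n <ᵇ a % n ] + M + a / n + pred ∣ a - b ∣ / n
  /-carry-> M {a} {b} a<b b-a≢0 with m≤n⇒∃[o]m+o≡n a<b
  ... | y , refl = subst (λ b → M + b / n ≡ [ b % n <ᵇ a % n ] + M + a / n + pred ∣ a - b ∣ / n)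
                         (+-suc a y) (begin
      M + Q
        ≡⟨ cong (λ q → M + q) quotient ⟩
      M + ([ R <ᵇ A ] + a / n + y / n)
        ≡⟨ move-indicator′ M [ R <ᵇ A ] (a / n) (y / n) ⟩
      [ R <ᵇ A ] + M + a / n + y / n
        ≡⟨ cong (λ g → [ R <ᵇ A ] + M + a / n + pred g / n) (∣m-m+n∣≡n a (suc y)) ⟨
      [ R <ᵇ A ] + M + a / n + pred ∣ a - a + suc y ∣ / n ∎)
    where
      open ≡-Reasoning
      Q = (a + suc y) / n
      R = (a + suc y) % n
      A = a % n
      A≢R : A ≢ R
      A≢R A≡R = b-a≢0 (begin
        (suc a + y ∸ a) % n   ≡⟨ cong (λ v → (v ∸ a) % n) (+-suc a y) ⟨
        (a + suc y ∸ a) % n   ≡⟨ cong (_% n) (m+n∸m≡n a (suc y)) ⟩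
        suc y % n             ≡⟨ %ℕ-+-cancelˡ (+ a) (suc y) 0 (trans (sym A≡R) (cong (_% n) (sym (+-identityʳ a)))) ⟩
        0 % n                 ≡⟨ 0%n≡0 n ⟩
        0                     ∎)
      quotient : Q ≡ [ R <ᵇ A ] + a / n + y / n
      quotient = +-cancelʳ-≡ 1 _ _ (begin
        Q + 1                              ≡⟨ cong (λ i → Q + i) (<ᵇ-exclusive A≢R) ⟨
        Q + ([ A <ᵇ R ] + [ R <ᵇ A ])      ≡⟨ +-assoc Q [ A <ᵇ R ] [ R <ᵇ A ] ⟨
        Q + [ A <ᵇ R ] + [ R <ᵇ A ]        ≡⟨ cong (_+ [ R <ᵇ A ]) (/-+-suc n a y) ⟩
        suc (a / n + y / n) + [ R <ᵇ A ]   ≡⟨ swap-indicator [ R <ᵇ A ] (a / n) (y / n) ⟩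
        [ R <ᵇ A ] + a / n + y / n + 1     ∎)

  count-congruent-to-end : ∀ lo g z → z ≡ lo +ℤ + 0 ⊎ z ≡ lo +ℤ + g →
                           count g (λ t → (0 <ᵇ t) ∧ ((lo +ℤ + t) %ℕ n ≡ᵇ z %ℕ n)) ≡ pred g / n
  count-congruent-to-end lo g z (inj₁ refl) = trans
    (count-cong g (λ {t} _ → cong ((0 <ᵇ t) ∧_) (trans (%ℕ-+-≡ᵇ lo t 0) (cong (t % n ≡ᵇ_) (0%n≡0 n)))))
    (multiples-below n g)
  count-congruent-to-end lo g z (inj₂ refl) = begin
      count g (λ t → (0 <ᵇ t) ∧ ((lo +ℤ + t) %ℕ n ≡ᵇ (lo +ℤ + g) %ℕ n))
        ≡⟨ count-reverse-open g (λ t → (lo +ℤ + t) %ℕ n ≡ᵇ (lo +ℤ + g) %ℕ n) ⟩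
      count g (λ t → (0 <ᵇ t) ∧ ((lo +ℤ + (g ∸ t)) %ℕ n ≡ᵇ (lo +ℤ + g) %ℕ n))
        ≡⟨ count-cong g (λ {t} t<g → cong ((0 <ᵇ t) ∧_) (complement t<g)) ⟩
      count g (λ t → (0 <ᵇ t) ∧ (t % n ≡ᵇ 0))
        ≡⟨ multiples-below n g ⟩
      pred g / n ∎
    where
      open ≡-Reasoning
      complement : ∀ {t} → t < g → ((lo +ℤ + (g ∸ t)) %ℕ n ≡ᵇ (lo +ℤ + g) %ℕ n) ≡ (t % n ≡ᵇ 0)
      complement {t} t<g = begin
          ((lo +ℤ + (g ∸ t)) %ℕ n ≡ᵇ (lo +ℤ + g) %ℕ n)
            ≡⟨ cong₂ (λ a b → a %ℕ n ≡ᵇ b %ℕ n) (sym (ℤ.+-identityʳ i)) split ⟩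
          ((i +ℤ + 0) %ℕ n ≡ᵇ (i +ℤ + t) %ℕ n)
            ≡⟨ %ℕ-+-≡ᵇ i 0 t ⟩
          (0 % n ≡ᵇ t % n)
            ≡⟨ ≡ᵇ-cong (λ eq → trans (sym eq) (0%n≡0 n)) (λ eq → trans (0%n≡0 n) (sym eq)) ⟩
          (t % n ≡ᵇ 0) ∎
        where
          i = lo +ℤ + (g ∸ t)
          split : lo +ℤ + g ≡ i +ℤ + t
          split = trans (cong (λ s → lo +ℤ + s) (sym (m∸n+n≡m (<⇒≤ t<g)))) (sym (ℤ.+-assoc lo (+ (g ∸ t)) (+ t)))

private
  add-difference : ∀ a b → a +ℤ (b -ℤ a) ≡ b
  add-difference = ℤ-Solver.solve-∀

⊓-gap-endpoints : ∀ x y → (x ≡ x ⊓ℤ y +ℤ + 0 × y ≡ x ⊓ℤ y +ℤ + ∣ x -ℤ y ∣)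
                        ⊎ (x ≡ x ⊓ℤ y +ℤ + ∣ x -ℤ y ∣ × y ≡ x ⊓ℤ y +ℤ + 0)
⊓-gap-endpoints x y with ℤ.≤-total x y
... | inj₁ x≤y = inj₁
  ( sym (trans (cong (_+ℤ + 0) (ℤ.i≤j⇒i⊓j≡i x≤y)) (ℤ.+-identityʳ x))
  , sym (trans (cong₂ _+ℤ_ (ℤ.i≤j⇒i⊓j≡i x≤y) (ℤ.∣-∣-≤ x≤y)) (add-difference x y)) )
... | inj₂ y≤x = inj₂
  ( sym (trans (cong₂ _+ℤ_ (ℤ.i≥j⇒i⊓j≡j y≤x) (trans (cong +_ (ℤ.∣i-j∣≡∣j-i∣ x y)) (ℤ.∣-∣-≤ y≤x)))
               (add-difference y x))
  , sym (trans (cong (_+ℤ + 0) (ℤ.i≥j⇒i⊓j≡j y≤x)) (ℤ.+-identityʳ y)) )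

-- The residue that diag counts is that of an endpoint of the gap, so it counts multiples of k+1.
diag≡ : ∀ k c₁ c₂ → diag k c₁ c₂ ≡ pred ∣ content c₁ -ℤ content c₂ ∣ / suc k
diag≡ k c₁ c₂ =
  count-congruent-to-end (suc k) (x ⊓ℤ y) ∣ x -ℤ y ∣ (content lower) (lower-is-endpoint (proj₁ c₂ <ᵇ proj₁ c₁))
  where
    x = content c₁
    y = content c₂
    lower = if proj₁ c₂ <ᵇ proj₁ c₁ then c₂ else c₁
    lower-is-endpoint : ∀ b → let z = content (if b then c₂ else c₁)
                              in z ≡ x ⊓ℤ y +ℤ + 0 ⊎ z ≡ x ⊓ℤ y +ℤ + ∣ x -ℤ y ∣
    lower-is-endpoint b with ⊓-gap-endpoints x y | b
    ... | inj₁ (x≡ , y≡) | false = inj₁ x≡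
    ... | inj₁ (x≡ , y≡) | true  = inj₂ y≡
    ... | inj₂ (x≡ , y≡) | false = inj₂ x≡
    ... | inj₂ (x≡ , y≡) | true  = inj₁ y≡

∣⊖∣≡∣-∣ : ∀ m n → ∣ m ⊖ n ∣ ≡ ∣ m - n ∣
∣⊖∣≡∣-∣ m n with ≤-total m n
... | inj₁ m≤n = trans (ℤ.∣⊖∣-≤ m≤n) (sym (m≤n⇒∣m-n∣≡n∸m m≤n))
... | inj₂ n≤m = trans (ℤ.∣m⊖n∣≡∣n⊖m∣ m n) (trans (ℤ.∣⊖∣-≤ n≤m) (sym (m≤n⇒∣n-m∣≡n∸m n≤m)))

content-offset : ∀ {r c W P} → c + P ≡ W + r → content (r , c) ≡ + W -ℤ + P
content-offset {r} {c} {W} {P} eq = begin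
    + c -ℤ + r                                     ≡⟨ regroup (+ c) (+ r) (+ P) (+ W) ⟩
    (+ c +ℤ + P) -ℤ (+ W +ℤ + r) +ℤ (+ W -ℤ + P)   ≡⟨ cong (λ v → + v -ℤ (+ W +ℤ + r) +ℤ (+ W -ℤ + P)) eq ⟩
    + (W + r) -ℤ + (W + r) +ℤ (+ W -ℤ + P)         ≡⟨ cong (_+ℤ (+ W -ℤ + P)) (ℤ.+-inverseʳ (+ (W + r))) ⟩
    + 0 +ℤ (+ W -ℤ + P)                            ≡⟨ ℤ.+-identityˡ (+ W -ℤ + P) ⟩
    + W -ℤ + P                                     ∎
  where
    open ≡-Reasoning
    regroup : ∀ c r p w → c -ℤ r ≡ (c +ℤ p) -ℤ (w +ℤ r) +ℤ (w -ℤ p)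
    regroup = ℤ-Solver.solve-∀

diag-offsets : ∀ k {W r₁ c₁ P₁ r₂ c₂ P₂} → c₁ + P₁ ≡ W + r₁ → c₂ + P₂ ≡ W + r₂ →
               diag k (r₁ , c₁) (r₂ , c₂) ≡ pred ∣ P₁ - P₂ ∣ / suc k
diag-offsets k {W} {r₁} {c₁} {P₁} {r₂} {c₂} {P₂} e₁ e₂ =
  trans (diag≡ k (r₁ , c₁) (r₂ , c₂)) (cong (λ d → pred d / suc k) (begin
    ∣ content (r₁ , c₁) -ℤ content (r₂ , c₂) ∣
      ≡⟨ cong ∣_∣ (cong₂ _-ℤ_ (content-offset {r₁} {c₁} {W} e₁) (content-offset {r₂} {c₂} {W} e₂)) ⟩
    ∣ (+ W -ℤ + P₁) -ℤ (+ W -ℤ + P₂) ∣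
      ≡⟨ cong ∣_∣ (trans (cancel (+ W) (+ P₁) (+ P₂)) (ℤ.[+m]-[+n]≡m⊖n P₂ P₁)) ⟩
    ∣ P₂ ⊖ P₁ ∣
      ≡⟨ ∣⊖∣≡∣-∣ P₂ P₁ ⟩
    ∣ P₂ - P₁ ∣
      ≡⟨ ∣-∣-comm P₂ P₁ ⟩
    ∣ P₁ - P₂ ∣ ∎))
  where
    open ≡-Reasoning
    cancel : ∀ w p q → (w -ℤ p) -ℤ (w -ℤ q) ≡ q -ℤ p
    cancel = ℤ-Solver.solve-∀

adjacent-residues-differ : ∀ {k} → 0 < k → ∀ r c → residue k (r , suc c) ≢ residue k (r , c)
adjacent-residues-differ {k} k>0 r c same = 1+n≢0 (begin
    1           ≡⟨ m<n⇒m%n≡m (s≤s k>0) ⟨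
    1 % suc k   ≡⟨ %ℕ-+-cancelˡ (suc k) (content (r , c)) 1 0 (begin
                     (content (r , c) +ℤ + 1) %ℕ suc k   ≡⟨ cong (_%ℕ suc k) next ⟨
                     residue k (r , suc c)               ≡⟨ same ⟩
                     residue k (r , c)                   ≡⟨ cong (_%ℕ suc k) (ℤ.+-identityʳ (content (r , c))) ⟨
                     (content (r , c) +ℤ + 0) %ℕ suc k   ∎) ⟩
    0           ∎)
  where
    open ≡-Reasoning
    shift : ∀ c r → (c +ℤ + 1) -ℤ r ≡ (c -ℤ r) +ℤ + 1
    shift = ℤ-Solver.solve-∀
    next : content (r , suc c) ≡ content (r , c) +ℤ + 1
    next = trans (cong (λ v → + v -ℤ + r) (+-comm 1 c)) (shift (+ c) (+ r))

module _ (k : ℕ) where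

  residue-offset : ∀ {r c W P} → c + P ≡ W + r → (P + residue k (r , c)) % suc k ≡ W % suc k
  residue-offset {r} {c} {W} {P} eq = begin
      (P + residue k (r , c)) % suc k                  ≡⟨ %-absorbˡ (suc k) P (residue k (r , c)) ⟨
      (P % suc k + content (r , c) %ℕ suc k) % suc k   ≡⟨ %ℕ-distrib-+ (suc k) (+ P) (content (r , c)) ⟨
      (+ P +ℤ content (r , c)) %ℕ suc k                ≡⟨ cong (λ z → (+ P +ℤ z) %ℕ suc k) (content-offset {r} {c} eq) ⟩
      (+ P +ℤ (+ W -ℤ + P)) %ℕ suc k                   ≡⟨ cong (_%ℕ suc k) (add-difference (+ P) (+ W)) ⟩
      W % suc k                                        ∎
    where open ≡-Reasoning

  residue-corner : ∀ W → residue k (0 , W) ≡ W % suc k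
  residue-corner W = cong (_%ℕ suc k) (ℤ.+-identityʳ (+ W))

  -- Both sides are the residue of −(p + 1) modulo k + 1.
  lowRank-offset : ∀ {sh r c W p} → c + suc p ≡ W + r →
                   lowRank k sh (residue k (0 , W)) (residue k (r , c)) ≡ k ∸ p % suc k
  lowRank-offset {sh} {r} {c} {W} {p} eq =
    +-%-cancelˡ-< n (suc p) (m%n<n (ρ + (n ∸ x)) n) (s≤s (m∸n≤m k (p % n))) (trans rank-inverse (sym formula-inverse))
    where
      open ≡-Reasoning
      n = suc k
      x = residue k (0 , W)
      ρ = residue k (r , c)
      x≡ : x ≡ W % n
      x≡ = residue-corner W
      ρ-offset : (suc p + ρ) % n ≡ W % n
      ρ-offset = residue-offset {r} {c} {W} {suc p} eq
      rank-inverse : (suc p + (ρ + (n ∸ x)) % n) % n ≡ 0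
      rank-inverse = begin
        (suc p + (ρ + (n ∸ x)) % n) % n   ≡⟨ %-absorbʳ n (suc p) (ρ + (n ∸ x)) ⟩
        (suc p + (ρ + (n ∸ x))) % n       ≡⟨ cong (_% n) (+-assoc (suc p) ρ (n ∸ x)) ⟨
        (suc p + ρ + (n ∸ x)) % n         ≡⟨ %-absorbˡ n (suc p + ρ) (n ∸ x) ⟨
        ((suc p + ρ) % n + (n ∸ x)) % n   ≡⟨ cong (λ v → (v + (n ∸ x)) % n) (trans ρ-offset (sym x≡)) ⟩
        (x + (n ∸ x)) % n                 ≡⟨ cong (_% n) (m+[n∸m]≡n (subst (_≤ n) (sym x≡) (<⇒≤ (m%n<n W n)))) ⟩
        n % n                             ≡⟨ n%n≡0 n ⟩
        0                                 ∎
      formula-inverse : (suc p + (k ∸ p % n)) % n ≡ 0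
      formula-inverse = begin
        (suc p + (k ∸ p % n)) % n                     ≡⟨ cong (λ v → (suc v + (k ∸ p % n)) % n) (m≡m%n+[m/n]*n p n) ⟩
        (suc (p % n + p / n * n) + (k ∸ p % n)) % n   ≡⟨ cong (_% n) (regroup (p % n) (p / n * n) (k ∸ p % n)) ⟩
        (suc (p % n + (k ∸ p % n)) + p / n * n) % n   ≡⟨ cong (λ v → (suc v + p / n * n) % n) (m+[n∸m]≡n p%n≤k) ⟩
        (n + p / n * n) % n                           ≡⟨ [m+kn]%n≡m%n n (p / n) n ⟩
        n % n                                         ≡⟨ n%n≡0 n ⟩
        0                                             ∎
        where
          p%n≤k = m<1+n⇒m≤n (m%n<n p n)
          regroup : ∀ a b c → suc (a + b) + c ≡ suc (a + c) + b
          regroup = solve-∀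

-- Partitions and the abacus

row-antitone : ∀ μ → IsPartition μ → ∀ {r r′} → r ≤ r′ → row μ r′ ≤ row μ r
row-antitone μ μ-part r≤r′ = go (≤⇒≤′ r≤r′)
  where
    go : ∀ {r r′} → r ≤′ r′ → row μ r′ ≤ row μ r
    go ≤′-refl = ≤-refl
    go (≤′-step {r′} r≤′r′) = ≤-trans (proj₂ μ-part r′) (go r≤′r′)

row-nonempty : ∀ μ {r} → 0 < row μ r → r < length μ
row-nonempty (_ ∷ _) {zero}  _ = z<s
row-nonempty (_ ∷ μ) {suc r} μr>0 = s≤s (row-nonempty μ μr>0)

module Abacus {μ : Partition} (μ-part : IsPartition μ) {w : ℕ} (wide : row μ 0 ≤ w) where

  -- Row r is recorded as a bead at position w + r − μ_r; positions strictly increase with r.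
  Bead : ℕ → Set
  Bead s = ∃[ r ] row μ r + s ≡ w + r

  row≤w : ∀ r → row μ r ≤ w
  row≤w r = ≤-trans (row-antitone μ μ-part z≤n) wide

  leg-by-rows : ∀ {r c r′} → r ≤ r′ → row μ (suc r′) ≤ c → c < row μ r′ → leg μ (r , c) ≡ r′ ∸ r
  leg-by-rows {r} {c} {r′} r≤r′ above-short below-long = begin
      count (length μ) (λ r″ → (r <ᵇ r″) ∧ (c <ᵇ row μ r″))
        ≡⟨ count-prefix _ (row-nonempty μ (≤-<-trans z≤n below-long)) (λ r′<t _ → short r′<t) ⟩
      count (suc r′) (λ r″ → (r <ᵇ r″) ∧ (c <ᵇ row μ r″))
        ≡⟨ count-cong (suc r′) (λ t≤r′ → long (m<1+n⇒m≤n t≤r′)) ⟩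
      count (suc r′) (r <ᵇ_)
        ≡⟨ count-above r (suc r′) ⟩
      r′ ∸ r ∎
    where
      open ≡-Reasoning
      short : ∀ {t} → r′ < t → (r <ᵇ t) ∧ (c <ᵇ row μ t) ≡ false
      short {t} r′<t = trans (cong ((r <ᵇ t) ∧_) (<ᵇ-false (≤⇒≯ (≤-trans (row-antitone μ μ-part r′<t) above-short))))
                             (∧-zeroʳ (r <ᵇ t))
      long : ∀ {t} → t ≤ r′ → (r <ᵇ t) ∧ (c <ᵇ row μ t) ≡ (r <ᵇ t)
      long {t} t≤r′ = trans (cong ((r <ᵇ t) ∧_) (<ᵇ-true (<-≤-trans below-long (row-antitone μ μ-part t≤r′))))
                            (∧-identityʳ (r <ᵇ t))

  hook-arithmetic : ∀ {R s r c t r′} → R + s ≡ w + r → c + t ≡ w + r′ → c < R → r ≤ r′ →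
                    (R ∸ suc c) + (r′ ∸ r) + 1 + s ≡ t
  hook-arithmetic {R} {s} {r} {c} {t} {r′} bead-r cell c<R r≤r′ = +-cancelʳ-≡ (c + r) _ _ (begin
      (R ∸ suc c) + (r′ ∸ r) + 1 + s + (c + r)   ≡⟨ regroup (R ∸ suc c) (r′ ∸ r) s c r ⟩
      ((R ∸ suc c) + suc c) + s + ((r′ ∸ r) + r) ≡⟨ cong₂ (λ a b → a + s + b) (m∸n+n≡m c<R) (m∸n+n≡m r≤r′) ⟩
      R + s + r′                                 ≡⟨ cong (_+ r′) bead-r ⟩
      w + r + r′                                 ≡⟨ swap w r r′ ⟩
      (w + r′) + r                               ≡⟨ cong (_+ r) cell ⟨
      c + t + r                                  ≡⟨ regroup′ c t r ⟩
      t + (c + r)                                ∎)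
    where
      open ≡-Reasoning
      regroup : ∀ a d s c r → a + d + 1 + s + (c + r) ≡ (a + suc c) + s + (d + r)
      regroup = solve-∀
      swap : ∀ w r r′ → w + r + r′ ≡ (w + r′) + r
      swap = solve-∀
      regroup′ : ∀ c t r → c + t + r ≡ t + (c + r)
      regroup′ = solve-∀

  -- Walking up from row r, the first row whose bead passes t determines a cell of row r
  -- with hook length t − s, unless some bead sits exactly at t.
  bead-or-hook : ∀ {r s t} → row μ r + s ≡ w + r → s < t → Bead t ⊎ ∃[ x ] x ∈P μ × hook μ x + s ≡ t
  bead-or-hook {r} {s} {t} bead-r s<t = walk t r ≤-refl (m≤m+n t r) start
    where
      start : w + r < row μ r + t
      start = subst (_< row μ r + t) bead-r (+-monoʳ-< (row μ r) s<t)
      walk : ∀ f r′ → r ≤ r′ → t ≤ f + r′ → w + r′ < row μ r′ + t →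
             Bead t ⊎ ∃[ x ] x ∈P μ × hook μ x + s ≡ t
      walk zero r′ _ t≤r′ below-t = contradiction below-t (≤⇒≯ (+-mono-≤ (row≤w r′) t≤r′))
      walk (suc f) r′ r≤r′ t≤f+r′ below-t with <-cmp (w + suc r′) (row μ (suc r′) + t)
      ... | tri< next _ _ = walk f (suc r′) (m≤n⇒m≤1+n r≤r′) (subst (t ≤_) (sym (+-suc f r′)) t≤f+r′) next
      ... | tri≈ _ at-t _ = inj₁ (suc r′ , sym at-t)
      ... | tri> _ _ past = inj₂ ((r , c) , <-≤-trans c<row (row-antitone μ μ-part r≤r′) , hook≡)
        where
          t≤w+r′ : t ≤ w + r′
          t≤w+r′ = m<1+n⇒m≤n (subst (t <_) (+-suc w r′) (≤-<-trans (m≤n+m t (row μ (suc r′))) past))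
          c = w + r′ ∸ t
          cell : c + t ≡ w + r′
          cell = m∸n+n≡m t≤w+r′
          c<row : c < row μ r′
          c<row = +-cancelʳ-< t c (row μ r′) (subst (_< row μ r′ + t) (sym cell) below-t)
          above-short : row μ (suc r′) ≤ c
          above-short = +-cancelʳ-≤ t (row μ (suc r′)) c
                          (m<1+n⇒m≤n (subst (row μ (suc r′) + t <_) (trans (+-suc w r′) (cong suc (sym cell))) past))
          hook≡ : hook μ (r , c) + s ≡ t
          hook≡ = trans (cong (λ l → arm μ (r , c) + l + 1 + s) (leg-by-rows r≤r′ above-short c<row))
                        (hook-arithmetic bead-r cell (<-≤-trans c<row (row-antitone μ μ-part r≤r′)) r≤r′)

  core-bead-shift : ∀ {k s} → IsCore k μ → Bead s → Bead (s + suc k)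
  core-bead-shift {k} {s} core (r , bead-r) with bead-or-hook bead-r (m<m+n s z<s)
  ... | inj₁ bead = bead
  ... | inj₂ (x , x∈μ , hook≡) = contradiction (+-cancelʳ-≡ s _ _ (trans hook≡ (+-comm s (suc k)))) (core x x∈μ)

  core-bead-shift* : ∀ {k s} → IsCore k μ → Bead s → ∀ J → Bead (s + J * suc k)
  core-bead-shift* {k} {s} core bead zero = subst Bead (sym (+-identityʳ s)) bead
  core-bead-shift* {k} {s} core bead (suc J) =
    subst Bead (next-multiple s J (suc k)) (core-bead-shift core (core-bead-shift* core bead J))
    where
      next-multiple : ∀ s J n → s + J * n + n ≡ s + suc J * n
      next-multiple = solve-∀

  gap-not-bead : ∀ {r s} → row μ r + s ≡ w + suc r → row μ (suc r) < row μ r → ¬ Bead s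
  gap-not-bead {r} {s} gap drop (r′ , bead) with r′ ≤? r
  ... | yes r′≤r = <-irrefl refl (begin-strict
      row μ r + s    ≤⟨ +-monoˡ-≤ s (row-antitone μ μ-part r′≤r) ⟩
      row μ r′ + s   ≡⟨ bead ⟩
      w + r′         ≤⟨ +-monoʳ-≤ w r′≤r ⟩
      w + r          <⟨ +-monoʳ-< w (n<1+n r) ⟩
      w + suc r      ≡⟨ gap ⟨
      row μ r + s    ∎)
    where open ≤-Reasoning
  ... | no r′≰r = <-irrefl refl (begin-strict
      row μ r′ + s   <⟨ +-monoˡ-< s (≤-<-trans (row-antitone μ μ-part (≰⇒> r′≰r)) drop) ⟩
      row μ r + s    ≡⟨ gap ⟩
      w + suc r      ≤⟨ +-monoʳ-≤ w (≰⇒> r′≰r) ⟩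
      w + r′         ≡⟨ bead ⟨
      row μ r′ + s   ∎)
    where open ≤-Reasoning

  core-gap-incongruent : ∀ {k r r′ s d} → IsCore k μ → row μ r + s ≡ w + r →
                         row μ r′ + (s + d) ≡ w + suc r′ → row μ (suc r′) < row μ r′ → d % suc k ≢ 0
  core-gap-incongruent {k} {r} {r′} {s} {d} core bead gap drop d%n≡0 =
    gap-not-bead gap drop (subst Bead (cong (λ e → s + e) (sym d≡)) (core-bead-shift* core (r , bead) (d / suc k)))
    where
      d≡ : d ≡ d / suc k * suc k
      d≡ = trans (m≡m%n+[m/n]*n d (suc k)) (cong (_+ d / suc k * suc k) d%n≡0)

-- Standard k-tableaux

module Tableau {k m} (k>0 : 0 < k) (tableau : StdKTableau k m) where
  open StdKTableau tableau

  newRow : ℕ → ℕ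
  newRow i = findFirst (length (sh (suc i))) (λ r → row (sh i) r <ᵇ row (sh (suc i)) r)

  private
    newRow-spec : ∀ {i} → suc i ≤ m → T (row (sh i) (newRow i) <ᵇ row (sh (suc i)) (newRow i))
                  × (∀ {r} → r < newRow i → ¬ T (row (sh i) r <ᵇ row (sh (suc i)) r))
    newRow-spec {i} h with sh-res i h
    ... | _ , ((r , c) , new , not-old) , _ =
      findFirst-spec (length (sh (suc i))) (λ r → row (sh i) r <ᵇ row (sh (suc i)) r)
        (row-nonempty (sh (suc i)) (≤-<-trans z≤n new)) (<⇒<ᵇ (≤-<-trans (≮⇒≥ not-old) new))

  newRow-grows : ∀ {i} → suc i ≤ m → row (sh i) (newRow i) < row (sh (suc i)) (newRow i)
  newRow-grows {i} h = <ᵇ⇒< (row (sh i) (newRow i)) (row (sh (suc i)) (newRow i)) (proj₁ (newRow-spec h))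

  unchanged-below-newRow : ∀ {i r} → suc i ≤ m → r < newRow i → row (sh (suc i)) r ≡ row (sh i) r
  unchanged-below-newRow {i} {r} h r<new =
    ≤-antisym (≮⇒≥ (λ grows → proj₂ (newRow-spec h) r<new (<⇒<ᵇ grows))) (sh-incl i h r)

  grows-by-one : ∀ {i r} → suc i ≤ m → row (sh i) r < row (sh (suc i)) r → row (sh (suc i)) r ≡ suc (row (sh i) r)
  grows-by-one {i} {r} h grows = ≤-antisym (≮⇒≥ two-new) grows
    where
      c = row (sh i) r
      same = proj₂ (proj₂ (sh-res i h))
      two-new : ¬ suc c < row (sh (suc i)) r
      two-new two = adjacent-residues-differ k>0 r c
        (trans (same (r , suc c) two (λ old → <-irrefl refl (<-trans (n<1+n c) old)))
               (sym (same (r , c) grows (<-irrefl refl))))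

lowDiag : ℕ → (ℕ → Partition) → ℕ → ℕ
lowDiag k sh i = diag k (lowCell k sh i) (lowAdd k sh i)

module Step {k m} (k>0 : 0 < k) (tableau : StdKTableau k m) (i : ℕ) (h : suc (suc i) ≤ m) where
  open StdKTableau tableau
  open Tableau k>0 tableau

  -- The cells (i+2)↓ and (i+1)↓ have offsets suc a′ and suc b′ from the width W.
  private
    h′ : suc i ≤ m
    h′ = ≤-trans (n≤1+n (suc i)) h
    n = suc k
    κ = sh i
    μ = sh (suc i)
    ν = sh (suc (suc i))
    ra = newRow (suc i)
    rb = newRow i
    W = row ν 0
    w = row μ 0
    a′ = W + ra ∸ suc (row μ ra)
    b′ = W + rb ∸ suc (row κ rb)
    w≤W : w ≤ W
    w≤W = sh-incl (suc i) h 0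
    M = Mw k sh (suc i)

  a-offset : row μ ra + suc a′ ≡ W + ra
  a-offset = <⇒+-suc-∸ (begin-strict
    row μ ra   <⟨ newRow-grows h ⟩
    row ν ra   ≤⟨ row-antitone ν (sh-part (suc (suc i)) h) z≤n ⟩
    W          ≤⟨ m≤m+n W ra ⟩
    W + ra     ∎)
    where open ≤-Reasoning

  b-offset : row κ rb + suc b′ ≡ W + rb
  b-offset = <⇒+-suc-∸ (begin-strict
    row κ rb   <⟨ newRow-grows h′ ⟩
    row μ rb   ≤⟨ row-antitone μ (sh-part (suc i) h′) z≤n ⟩
    w          ≤⟨ w≤W ⟩
    W          ≤⟨ m≤m+n W rb ⟩
    W + rb     ∎)
    where open ≤-Reasoning

  bottom-row-kept : 0 < ra → W ≡ w
  bottom-row-kept = unchanged-below-newRow h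

  bottom-row-grown : ra ≡ 0 → W ≡ suc w
  bottom-row-grown ra≡0 = grows-by-one h (subst (λ r → row μ r < row ν r) ra≡0 (newRow-grows h))

  a′≡0 : ra ≡ 0 → a′ ≡ 0
  a′≡0 ra≡0 = suc-injective (+-cancelˡ-≡ w (suc a′) 1 (begin
      w + suc a′   ≡⟨ subst (λ r → row μ r + suc a′ ≡ W + r) ra≡0 a-offset ⟩
      W + 0        ≡⟨ +-identityʳ W ⟩
      W            ≡⟨ bottom-row-grown ra≡0 ⟩
      suc w        ≡⟨ +-comm 1 w ⟩
      w + 1        ∎))
    where open ≡-Reasoning

  b′<a′ : rb < ra → b′ < a′
  b′<a′ rb<ra = ≤-pred (+-cancelˡ-< (row κ rb) (suc b′) (suc a′) (begin-strict
      row κ rb + suc b′   ≡⟨ b-offset ⟩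
      W + rb              <⟨ +-monoʳ-< W rb<ra ⟩
      W + ra              ≡⟨ a-offset ⟨
      row μ ra + suc a′   ≤⟨ +-monoˡ-≤ (suc a′) μra≤κrb ⟩
      row κ rb + suc a′   ∎))
    where
      open ≤-Reasoning
      μra≤κrb : row μ ra ≤ row κ rb
      μra≤κrb = ≤-trans (row-antitone μ (sh-part (suc i) h′) rb<ra) (sh-horiz i h′ rb)

  a′<b′-if : ra ≤ rb → a′ < b′
  a′<b′-if ra≤rb = ≤-pred (+-cancelˡ-< (row μ ra) (suc a′) (suc b′) (begin-strict
      row μ ra + suc a′   ≡⟨ a-offset ⟩
      W + ra              ≤⟨ +-monoʳ-≤ W ra≤rb ⟩
      W + rb              ≡⟨ b-offset ⟨
      row κ rb + suc b′   <⟨ +-monoˡ-< (suc b′) (newRow-grows h′) ⟩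
      row μ rb + suc b′   ≤⟨ +-monoˡ-≤ (suc b′) (row-antitone μ (sh-part (suc i) h′) ra≤rb) ⟩
      row μ ra + suc b′   ∎))
    where open ≤-Reasoning

  -- On the abacus of μ of width W, suc a′ is a bead and suc b′ is a gap.
  gap-incongruent : a′ < b′ → (b′ ∸ a′) % n ≢ 0
  gap-incongruent a′<b′ =
    Abacus.core-gap-incongruent {μ} (sh-part (suc i) h′) {W} w≤W (sh-core (suc i) h′) a-offset gap drop
    where
      open ≡-Reasoning
      drop : row μ (suc rb) < row μ rb
      drop = ≤-<-trans (sh-horiz i h′ rb) (newRow-grows h′)
      gap : row μ rb + (suc a′ + (b′ ∸ a′)) ≡ W + suc rb
      gap = begin
        row μ rb + (suc a′ + (b′ ∸ a′))   ≡⟨ cong (λ s → row μ rb + suc s) (m+[n∸m]≡n (<⇒≤ a′<b′)) ⟩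
        row μ rb + suc b′                 ≡⟨ cong (_+ suc b′) (grows-by-one h′ (newRow-grows h′)) ⟩
        suc (row κ rb + suc b′)           ≡⟨ cong suc b-offset ⟩
        suc (W + rb)                      ≡⟨ +-suc W rb ⟨
        W + suc rb                        ∎

  lowDiag-new : lowDiag k sh (suc (suc i)) ≡ a′ / n
  lowDiag-new = diag-offsets k {W} {ra} {row μ ra} {suc a′} {0} {W} {0} a-offset refl

  lowDiag-old-kept : W ≡ w → lowDiag k sh (suc i) ≡ b′ / n
  lowDiag-old-kept W≡w =
    diag-offsets k {w} {rb} {row κ rb} {suc b′} {0} {w} {0} (subst (λ v → row κ rb + suc b′ ≡ v + rb) W≡w b-offset) refl

  lowDiag-old-grown : W ≡ suc w → lowDiag k sh (suc i) ≡ pred b′ / n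
  lowDiag-old-grown W≡1+w = trans (diag-offsets k {w} {rb} {row κ rb} {b′} {0} {w} {0} (suc-injective (begin
      suc (row κ rb + b′)   ≡⟨ +-suc (row κ rb) b′ ⟨
      row κ rb + suc b′     ≡⟨ b-offset ⟩
      W + rb                ≡⟨ cong (_+ rb) W≡1+w ⟩
      suc (w + rb)          ∎)) refl) (cong (λ d → pred d / n) (∣-∣-identityʳ b′))
    where open ≡-Reasoning

  diag-new-old : diag k (lowCell k sh (suc (suc i))) (lowCell k sh (suc i)) ≡ pred ∣ a′ - b′ ∣ / n
  diag-new-old = diag-offsets k {W} {ra} {row μ ra} {suc a′} {rb} {row κ rb} {suc b′} a-offset b-offset

  Mw-step : Mw k sh (suc (suc i)) ≡ [ b′ % n <ᵇ a′ % n ] + M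
  Mw-step = trans (if-then-suc _ M) (cong (λ g → [ g ] + M) (begin
      lowRank k sh x (residue k (ra , row μ ra)) <ᵇ lowRank k sh x (residue k (rb , row κ rb))
        ≡⟨ cong₂ _<ᵇ_ (lowRank-offset k {sh} {ra} {row μ ra} {W} {a′} a-offset)
                      (lowRank-offset k {sh} {rb} {row κ rb} {W} {b′} b-offset) ⟩
      k ∸ a′ % n <ᵇ k ∸ b′ % n
        ≡⟨ ∸-<ᵇ-flip (m<1+n⇒m≤n (m%n<n a′ n)) ⟩
      b′ % n <ᵇ a′ % n ∎))
    where
      open ≡-Reasoning
      x = residue k (0 , W)

  private
    drop-added : ∀ x d → (x +ℤ d) -ℤ d ≡ x
    drop-added = ℤ-Solver.solve-∀
    L = Lw k sh (suc i)
    D = diag k (lowCell k sh (suc (suc i))) (lowCell k sh (suc i))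

  Lw-below : rb < ra → Lw k sh (suc (suc i)) ≡ L +ℤ + 1 +ℤ + D
  Lw-below rb<ra = cong (λ c → if c then L +ℤ + 1 +ℤ + D else L -ℤ + D) (<ᵇ-true rb<ra)

  Lw-above : ¬ rb < ra → Lw k sh (suc (suc i)) ≡ L -ℤ + D
  Lw-above rb≮ra = cong (λ c → if c then L +ℤ + 1 +ℤ + D else L -ℤ + D) (<ᵇ-false rb≮ra)

  step-below : rb < ra → L ≡ + (M + lowDiag k sh (suc i)) →
               Lw k sh (suc (suc i)) ≡ + (Mw k sh (suc (suc i)) + lowDiag k sh (suc (suc i)))
  step-below rb<ra IH = begin
      Lw k sh (suc (suc i))
        ≡⟨ Lw-below rb<ra ⟩
      L +ℤ + 1 +ℤ + D
        ≡⟨ cong₂ (λ l d → l +ℤ + 1 +ℤ + d) (trans IH (cong (λ d → + (M + d)) (lowDiag-old-kept W≡w))) diag-new-old ⟩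
      + (M + b′ / n + 1 + pred ∣ a′ - b′ ∣ / n)
        ≡⟨ cong (λ v → + v) (/-carry-< n M (b′<a′ rb<ra)) ⟩
      + ([ b′ % n <ᵇ a′ % n ] + M + a′ / n)
        ≡⟨ cong₂ (λ l d → + (l + d)) Mw-step lowDiag-new ⟨
      + (Mw k sh (suc (suc i)) + lowDiag k sh (suc (suc i))) ∎
    where
      open ≡-Reasoning
      W≡w = bottom-row-kept (≤-<-trans z≤n rb<ra)

  step-bottom : ¬ rb < ra → ra ≡ 0 → L ≡ + (M + lowDiag k sh (suc i)) →
                Lw k sh (suc (suc i)) ≡ + (Mw k sh (suc (suc i)) + lowDiag k sh (suc (suc i)))
  step-bottom rb≮ra ra≡0 IH = begin
      Lw k sh (suc (suc i))
        ≡⟨ Lw-above rb≮ra ⟩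
      L -ℤ + D
        ≡⟨ cong₂ (λ l d → l -ℤ + d) (trans IH (cong (λ d → + (M + d)) (lowDiag-old-grown (bottom-row-grown ra≡0))))
                 diag-new-old ⟩
      + (M + pred b′ / n) -ℤ + (pred ∣ a′ - b′ ∣ / n)
        ≡⟨ cong (λ a → + (M + pred b′ / n) -ℤ + (pred ∣ a - b′ ∣ / n)) (a′≡0 ra≡0) ⟩
      + (M + pred b′ / n) -ℤ + (pred b′ / n)
        ≡⟨ drop-added (+ M) (+ (pred b′ / n)) ⟩
      + M
        ≡⟨ cong (λ v → + v) (+-identityʳ M) ⟨
      + ([ b′ % n <ᵇ 0 ] + M + 0 / n)
        ≡⟨ cong (λ a → + ([ b′ % n <ᵇ a % n ] + M + a / n)) (a′≡0 ra≡0) ⟨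
      + ([ b′ % n <ᵇ a′ % n ] + M + a′ / n)
        ≡⟨ cong₂ (λ l d → + (l + d)) Mw-step lowDiag-new ⟨
      + (Mw k sh (suc (suc i)) + lowDiag k sh (suc (suc i))) ∎
    where open ≡-Reasoning

  step-above : 0 < ra → ra ≤ rb → L ≡ + (M + lowDiag k sh (suc i)) →
               Lw k sh (suc (suc i)) ≡ + (Mw k sh (suc (suc i)) + lowDiag k sh (suc (suc i)))
  step-above 0<ra ra≤rb IH = begin
      Lw k sh (suc (suc i))
        ≡⟨ Lw-above (≤⇒≯ ra≤rb) ⟩
      L -ℤ + D
        ≡⟨ cong₂ (λ l d → l -ℤ + d) (trans IH (cong (λ d → + (M + d)) (lowDiag-old-kept (bottom-row-kept 0<ra))))
                 diag-new-old ⟩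
      + (M + b′ / n) -ℤ + (pred ∣ a′ - b′ ∣ / n)
        ≡⟨ cong (λ v → + v -ℤ + (pred ∣ a′ - b′ ∣ / n)) (/-carry-> n M a′<b′ (gap-incongruent a′<b′)) ⟩
      + ([ b′ % n <ᵇ a′ % n ] + M + a′ / n + pred ∣ a′ - b′ ∣ / n) -ℤ + (pred ∣ a′ - b′ ∣ / n)
        ≡⟨ drop-added (+ ([ b′ % n <ᵇ a′ % n ] + M + a′ / n)) (+ (pred ∣ a′ - b′ ∣ / n)) ⟩
      + ([ b′ % n <ᵇ a′ % n ] + M + a′ / n)
        ≡⟨ cong₂ (λ l d → + (l + d)) Mw-step lowDiag-new ⟨
      + (Mw k sh (suc (suc i)) + lowDiag k sh (suc (suc i))) ∎
    where
      open ≡-Reasoning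
      a′<b′ = a′<b′-if ra≤rb

  step : L ≡ + (M + lowDiag k sh (suc i)) →
         Lw k sh (suc (suc i)) ≡ + (Mw k sh (suc (suc i)) + lowDiag k sh (suc (suc i)))
  step IH with rb <? ra | ra ≟ 0
  ... | yes rb<ra | _        = step-below rb<ra IH
  ... | no  rb≮ra | yes ra≡0 = step-bottom rb≮ra ra≡0 IH
  ... | no  rb≮ra | no  ra≢0 = step-above (n≢0⇒n>0 ra≢0) (≮⇒≥ rb≮ra) IH

module Cocharge {k m} (k>0 : 0 < k) (tableau : StdKTableau k m) where
  open StdKTableau tableau
  open Tableau k>0 tableau

  first-letter : 1 ≤ m → Lw k sh 1 ≡ + (Mw k sh 1 + lowDiag k sh 1)
  first-letter h = cong (λ d → + d)
    (sym (diag-offsets k {row (sh 1) 0} {newRow 0} {row (sh 0) (newRow 0)} {1} {0} {row (sh 1) 0} {0} offset refl))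
    where
      open ≡-Reasoning
      empty : ∀ r → row (sh 0) r ≡ 0
      empty r = cong (λ μ → row μ r) sh-zero
      grows-only-at-bottom : ∀ {r} → row (sh 0) r < row (sh 1) r → r ≡ 0
      grows-only-at-bottom {zero}  _     = refl
      grows-only-at-bottom {suc r} grows =
        contradiction (≤-trans (sh-horiz 0 h r) (≤-reflexive (empty r))) (<⇒≱ (≤-<-trans z≤n grows))
      r≡0 : newRow 0 ≡ 0
      r≡0 = grows-only-at-bottom (newRow-grows h)
      one : row (sh 1) 0 ≡ 1
      one = trans (grows-by-one h (subst (λ r → row (sh 0) r < row (sh 1) r) r≡0 (newRow-grows h))) (cong suc (empty 0))
      offset : row (sh 0) (newRow 0) + 1 ≡ row (sh 1) 0 + newRow 0
      offset = begin
        row (sh 0) (newRow 0) + 1   ≡⟨ cong (_+ 1) (empty (newRow 0)) ⟩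
        1                           ≡⟨ cong₂ _+_ one r≡0 ⟨
        row (sh 1) 0 + newRow 0     ∎

  Lw≡Mw+lowDiag : ∀ i → 1 ≤ i → i ≤ m → Lw k sh i ≡ + (Mw k sh i + lowDiag k sh i)
  Lw≡Mw+lowDiag 1             _ h = first-letter h
  Lw≡Mw+lowDiag (suc (suc i)) _ h =
    Step.step k>0 tableau i h (Lw≡Mw+lowDiag (suc i) (s≤s z≤n) (≤-trans (n≤1+n (suc i)) h))

  cocharge-prefix : ∀ l → l ≤ m → sum1toℤ l (Lw k sh) ≡ + sum1to l (λ i → Mw k sh i + lowDiag k sh i)
  cocharge-prefix zero    _ = refl
  cocharge-prefix (suc l) h =
    cong₂ _+ℤ_ (cocharge-prefix l (≤-trans (n≤1+n l) h)) (Lw≡Mw+lowDiag (suc l) (s≤s z≤n) h)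

theorem4p8 : (k m : ℕ) → 0 < k → (T : StdKTableau k m) →
    kCocharge k (StdKTableau.sh T) m
      ≡ + sum1to m (λ i → Mw k (StdKTableau.sh T) i
                          + diag k (lowCell k (StdKTableau.sh T) i)
                                   (lowAdd k (StdKTableau.sh T) i))
theorem4p8 k m k>0 T = Cocharge.cocharge-prefix k>0 T m ≤-refl
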